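{- Let $n\ge3$ and let $C_n$ be a directed cycle graph on vertices $v_1,\dots,v_n$ such that $v_1$ has no outgoing arrows and every other vertex has exactly two outgoing arrows. Then $\operatorname{Pic}(C_n)\cong\mathbb{Z}\times\operatorname{Jac}(C_n)$ with $\operatorname{Jac}(C_n)\cong\mathbb{Z}_n$.
   Context: A directed cycle graph on vertices $v_1,\dots,v_n$ (cyclic order) has, for each cyclically consecutive pair, exactly one arrow, either one-directional or bi-directional; a bi-directional arrow between $u,w$ counts as an outgoing arrow of both $u$ and $w$ (an arrow from $u$ to $w$ and one from $w$ to $u$). The Laplacian $L_G$ is the $n\times n$ integer matrix with $(i,i)$ entry the number of outgoing arrows of $v_i$ and $(i,j)$ entry ($i\ne j$) minus the number of arrows from $v_i$ to $v_j$. $\operatorname{Pic}(G)=\mathbb{Z}^n/L_G^T\mathbb{Z}^n$, $\operatorname{Jac}(G)$ is its torsion subgroup, $\mathbb{Z}_n=\mathbb{Z}/n\mathbb{Z}$. -}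

module Defs where

open import Data.Nat as ℕ using (ℕ; zero; suc)
open import Data.Nat.DivMod using (_%_; m%n<n)
open import Data.Fin using (Fin; zero; suc; toℕ; fromℕ<; _≟_)
open import Data.Integer as ℤ using (ℤ; +_; _+_; _*_; -_)
open import Data.Integer.Divisibility using (_∣_)
open import Data.Product using (Σ; ∃; _×_; _,_)
open import Function.Bundles using (_⇔_)
open import Relation.Nullary using (yes; no)
open import Relation.Binary.PropositionalEquality using (_≡_)

-- The arrow on the edge between v_i and v_{i+1} (cyclically):
--   fwd  : v_i → v_{i+1};  bwd : v_{i+1} → v_i;  both : bi-directional.
data Arrow : Set where
  fwd bwd both : Arrow

-- A directed cycle graph on n vertices (indexed by Fin n; v_1 = zero):
-- one arrow for each cyclically consecutive pair (i, i+1 mod n).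
CycleGraph : ℕ → Set
CycleGraph n = Fin n → Arrow

next : ∀ {k} → Fin (suc k) → Fin (suc k)
next {k} i = fromℕ< (m%n<n (suc (toℕ i)) (suc k))

forwardCount : Arrow → ℕ
forwardCount fwd  = 1
forwardCount bwd  = 0
forwardCount both = 1

backwardCount : Arrow → ℕ
backwardCount fwd  = 0
backwardCount bwd  = 1
backwardCount both = 1

arrows : ∀ {k} → CycleGraph (suc k) → Fin (suc k) → Fin (suc k) → ℕ
arrows G u w = fw ℕ.+ bw
  where
  fw : ℕ
  fw with w ≟ next u
  ... | yes _ = forwardCount (G u)
  ... | no  _ = 0
  bw : ℕ
  bw with u ≟ next w
  ... | yes _ = backwardCount (G w)
  ... | no  _ = 0

sumℕ : ∀ {n} → (Fin n → ℕ) → ℕ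
sumℕ {zero}  f = 0
sumℕ {suc n} f = f zero ℕ.+ sumℕ (λ i → f (suc i))

sumℤ : ∀ {n} → (Fin n → ℤ) → ℤ
sumℤ {zero}  f = + 0
sumℤ {suc n} f = f zero + sumℤ (λ i → f (suc i))

outdeg : ∀ {k} → CycleGraph (suc k) → Fin (suc k) → ℕ
outdeg G v = sumℕ (λ w → arrows G v w)

laplacian : ∀ {k} → CycleGraph (suc k) → Fin (suc k) → Fin (suc k) → ℤ
laplacian G i j with i ≟ j
... | yes _ = + outdeg G i
... | no  _ = - (+ arrows G i j)

ℤVec : ℕ → Set
ℤVec n = Fin n → ℤ

_+ᵥ_ : ∀ {n} → ℤVec n → ℤVec n → ℤVec n
(x +ᵥ y) i = x i + y i

_·ᵥ_ : ∀ {n} → ℤ → ℤVec n → ℤVec n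
(k ·ᵥ x) i = k * x i

InImLT : ∀ {k} → CycleGraph (suc k) → ℤVec (suc k) → Set
InImLT {k} G x = ∃ λ (y : ℤVec (suc k)) → ∀ j → x j ≡ sumℤ (λ i → laplacian G i j * y i)

-- the class of x in Pic(G) = ℤ^n / L^T ℤ^n is torsion (i.e. lies in Jac(G)):
-- some positive multiple (suc m)·x lies in L^T ℤ^n
IsTorsionInPic : ∀ {k} → CycleGraph (suc k) → ℤVec (suc k) → Set
IsTorsionInPic G x = ∃ λ (m : ℕ) → InImLT G ((+ suc m) ·ᵥ x)

Additive : ∀ {n} → (ℤVec n → ℤ) → Set
Additive f = ∀ x y → f (x +ᵥ y) ≡ f x + f y

infix 4 _≡[mod_]_
_≡[mod_]_ : ℤ → ℕ → ℤ → Set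
a ≡[mod n ] b = (+ n) ∣ (a ℤ.- b)

-- Pic(G) ≅ ℤ × ℤ_N : a surjective homomorphism ℤ^n → ℤ × ℤ/Nℤ,  x ↦ (f x, g x mod N),
-- whose kernel is exactly L^T ℤ^n.
PicIsoℤ×ℤ/ : ∀ {k} → CycleGraph (suc k) → ℕ → Set
PicIsoℤ×ℤ/ {k} G N =
  Σ (ℤVec (suc k) → ℤ) λ f → Σ (ℤVec (suc k) → ℤ) λ g →
    Additive f × Additive g
    × (∀ a b → ∃ λ x → f x ≡ a × g x ≡[mod N ] b)
    × (∀ x → InImLT G x ⇔ (f x ≡ + 0 × g x ≡[mod N ] + 0))

-- Jac(G) ≅ ℤ_N : a homomorphism g : ℤ^n → ℤ whose restriction to the torsion
-- classes, composed with ℤ → ℤ/Nℤ, is surjective with kernel exactly L^T ℤ^n.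
JacIsoℤ/ : ∀ {k} → CycleGraph (suc k) → ℕ → Set
JacIsoℤ/ {k} G N =
  Σ (ℤVec (suc k) → ℤ) λ g →
    Additive g
    × (∀ b → ∃ λ x → IsTorsionInPic G x × g x ≡[mod N ] b)
    × (∀ x → IsTorsionInPic G x → (InImLT G x ⇔ g x ≡[mod N ] + 0))

-- The hypotheses force v₁ to be a sink and every other vertex to have exactly one
-- arrow to each neighbour.  Hence the j-th entry of L_G^T y is the cyclic second
-- difference 2zⱼ − zⱼ₋₁ − zⱼ₊₁ of z = y with its v₁-entry set to 0, so L_G^T ℤⁿ is the
-- image of the second-difference operator Δ on vectors vanishing at v₁.  Summation by
-- parts shows that Δw has total sum 0 and first moment Σ j·(Δw)ⱼ = n (w_{n−1} − w₀);
-- conversely a vector with sum 0 and first moment c·n is Δw for the w with w₀ = 0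
-- obtained by summing it twice.  So x ↦ (Σ xⱼ, Σ j·xⱼ mod n) identifies Pic(C_n) with
-- ℤ × ℤ_n, and its torsion, the classes of sum 0, with ℤ_n.

module Submission where

open import Algebra.Bundles using (CommutativeMonoid)
open import Data.Fin using (Fin; zero; suc; toℕ; fromℕ; inject₁; punchIn; _≟_)
open import Data.Fin.Permutation using (permutation)
open import Data.Fin.Properties using (toℕ-injective; toℕ-fromℕ<; toℕ-fromℕ; toℕ-inject₁; toℕ<n; punchInᵢ≢i; 0≢1+n)
open import Data.Fin.Relation.Unary.Top using (view; ‵fromℕ; ‵inj₁)
open import Data.Integer using (ℤ; +_; _+_; _-_; _*_; -_)
import Data.Integer.Divisibility.Signed as Signed
import Data.Integer.Properties as ℤP
open import Data.Integer.Tactic.RingSolver using (solve-∀)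
open import Data.Nat as ℕ using (ℕ; zero; suc; s≤s)
open import Data.Nat.DivMod using (m<n⇒m%n≡m; n%n≡0)
import Data.Nat.Properties as ℕP
open import Data.Empty using (⊥-elim)
open import Data.Product using (∃; _×_; _,_; proj₁; proj₂)
open import Data.Vec.Functional using (Vector; replicate)
open import Function.Base using (_∘_)
open import Function.Bundles using (_⇔_; mk⇔; module Equivalence)
open import Relation.Binary.PropositionalEquality
  using (_≡_; _≢_; _≗_; refl; sym; trans; cong; cong₂; module ≡-Reasoning)
open import Relation.Nullary using (yes; no)

open import Defs

module _ {c ℓ} (M : CommutativeMonoid c ℓ) where
  open CommutativeMonoid M using (Carrier; _≈_; _∙_; ε; ∙-congˡ; identityʳ; setoid)
  open import Algebra.Properties.CommutativeMonoid.Sum M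
    using (sum; sum-remove; sum-cong-≋; sum-replicate-zero)
  open import Relation.Binary.Reasoning.Setoid setoid

  sum-concentrated : ∀ {n} (f : Vector Carrier (suc n)) a →
                     (∀ i → i ≢ a → f i ≈ ε) → sum f ≈ f a
  sum-concentrated {n} f a vanish = begin
    sum f                                 ≈⟨ sum-remove {i = a} f ⟩
    f a ∙ sum (λ i → f (punchIn a i))     ≈⟨ ∙-congˡ (sum-cong-≋ (λ i → vanish _ (punchInᵢ≢i a i))) ⟩
    f a ∙ sum (replicate n ε)             ≈⟨ ∙-congˡ (sum-replicate-zero n) ⟩
    f a ∙ ε                               ≈⟨ identityʳ _ ⟩
    f a                                   ∎

open import Algebra.Properties.Semiring.Sum ℤP.+-*-semiring
  using (sum; sum-cong-≗; ∑-distrib-+; *-distribˡ-sum; sum-init-last; sum-permute; sum-replicate-zero)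
import Algebra.Properties.CommutativeMonoid.Sum ℕP.+-0-commutativeMonoid as ℕΣ

sumℤ≡sum : ∀ {n} (f : ℤVec n) → sumℤ f ≡ sum f
sumℤ≡sum {zero}  f = refl
sumℤ≡sum {suc n} f = cong (_+_ (f zero)) (sumℤ≡sum (f ∘ suc))

sumℕ≡sum : ∀ {n} (f : Fin n → ℕ) → sumℕ f ≡ ℕΣ.sum f
sumℕ≡sum {zero}  f = refl
sumℕ≡sum {suc n} f = cong (f zero ℕ.+_) (sumℕ≡sum (f ∘ suc))

∑-distrib-neg : ∀ {n} (f : ℤVec n) → sum (λ i → - f i) ≡ - sum f
∑-distrib-neg f = begin
  sum (λ i → - f i)             ≡⟨ sum-cong-≗ (λ i → sym (ℤP.-1*i≡-i (f i))) ⟩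
  sum (λ i → - + 1 * f i)       ≡⟨ *-distribˡ-sum (- + 1) f ⟨
  - + 1 * sum f                 ≡⟨ ℤP.-1*i≡-i (sum f) ⟩
  - sum f                       ∎
  where open ≡-Reasoning

∑-distrib-- : ∀ {n} (f g : ℤVec n) → sum (λ i → f i - g i) ≡ sum f - sum g
∑-distrib-- f g = trans (∑-distrib-+ f (-_ ∘ g)) (cong (_+_ (sum f)) (∑-distrib-neg g))

prev : ∀ {k} → Fin (suc k) → Fin (suc k)
prev {k} zero    = fromℕ k
prev     (suc i) = inject₁ i

next-inject₁ : ∀ {k} (i : Fin k) → next (inject₁ i) ≡ suc i
next-inject₁ {k} i = toℕ-injective (begin
  toℕ (next (inject₁ i))            ≡⟨ toℕ-fromℕ< _ ⟩
  suc (toℕ (inject₁ i)) ℕ.% suc k   ≡⟨ cong (λ t → suc t ℕ.% suc k) (toℕ-inject₁ i) ⟩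
  suc (toℕ i) ℕ.% suc k             ≡⟨ m<n⇒m%n≡m (s≤s (toℕ<n i)) ⟩
  suc (toℕ i)                       ∎)
  where open ≡-Reasoning

next-fromℕ : ∀ k → next (fromℕ k) ≡ zero
next-fromℕ k = toℕ-injective (begin
  toℕ (next (fromℕ k))              ≡⟨ toℕ-fromℕ< _ ⟩
  suc (toℕ (fromℕ k)) ℕ.% suc k     ≡⟨ cong (λ t → suc t ℕ.% suc k) (toℕ-fromℕ k) ⟩
  suc k ℕ.% suc k                   ≡⟨ n%n≡0 (suc k) ⟩
  0                                 ∎)
  where open ≡-Reasoning

next-prev : ∀ {k} (i : Fin (suc k)) → next (prev i) ≡ i
next-prev {k} zero    = next-fromℕ k
next-prev     (suc i) = next-inject₁ i

prev-next : ∀ {k} (i : Fin (suc k)) → prev (next i) ≡ i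
prev-next {k} i with view i
... | ‵fromℕ          = cong prev (next-fromℕ k)
... | ‵inj₁ {i = j} _ = cong prev (next-inject₁ j)

next≢ : ∀ {k} (i : Fin (suc (suc k))) → next i ≢ i
next≢ {k} i with view i
... | ‵fromℕ          rewrite next-fromℕ (suc k) = 0≢1+n
... | ‵inj₁ {i = j} _ rewrite next-inject₁ j    = λ eq → ℕP.1+n≢n (trans (cong toℕ eq) (toℕ-inject₁ j))

sum-∘next : ∀ {k} (f : ℤVec (suc k)) → sum (f ∘ next) ≡ sum f
sum-∘next f = sym (sum-permute f (permutation next prev next-prev prev-next))

sum-∘prev : ∀ {k} (f : ℤVec (suc k)) → sum (f ∘ prev) ≡ sum f
sum-∘prev f = trans (sym (sum-∘next (f ∘ prev))) (sum-cong-≗ (cong f ∘ prev-next))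

δ : ∀ {n} → Fin n → ℕ → Fin n → ℕ
δ a c i with i ≟ a
... | yes _ = c
... | no  _ = 0

δ-self : ∀ {n} (a : Fin n) c → δ a c a ≡ c
δ-self a c with a ≟ a
... | yes _   = refl
... | no  a≢a = ⊥-elim (a≢a refl)

δ-other : ∀ {n} {a i : Fin n} c → i ≢ a → δ a c i ≡ 0
δ-other {a = a} {i} c i≢a with i ≟ a
... | yes i≡a = ⊥-elim (i≢a i≡a)
... | no  _   = refl

sum-δ : ∀ {k} (a : Fin (suc k)) c → ℕΣ.sum (δ a c) ≡ c
sum-δ a c = trans (sum-concentrated ℕP.+-0-commutativeMonoid (δ a c) a (λ _ → δ-other c)) (δ-self a c)

sum-δ* : ∀ {k} (a : Fin (suc k)) c (y : ℤVec (suc k)) → sum (λ i → + δ a c i * y i) ≡ + c * y a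
sum-δ* a c y = trans (sum-concentrated ℤP.+-0-commutativeMonoid (λ i → + δ a c i * y i) a
                        (λ i i≢a → cong (λ t → + t * y i) (δ-other c i≢a)))
                     (cong (λ t → + t * y a) (δ-self a c))

module _ {k} (G : CycleGraph (suc k)) where

  arrows-row : ∀ u w →
    arrows G u w ≡ δ (next u) (forwardCount (G u)) w ℕ.+ δ (prev u) (backwardCount (G (prev u))) w
  arrows-row u w with w ≟ next u | u ≟ next w | w ≟ prev u
  ... | _     | yes u≡ | no  w≢ = ⊥-elim (w≢ (trans (sym (prev-next w)) (cong prev (sym u≡))))
  ... | _     | no  u≢ | yes w≡ = ⊥-elim (u≢ (trans (sym (next-prev u)) (cong next (sym w≡))))
  ... | yes _ | yes _  | yes refl = refl
  ... | no  _ | yes _  | yes refl = refl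
  ... | yes _ | no  _  | no  _ = refl
  ... | no  _ | no  _  | no  _ = refl

  arrows-column : ∀ i j →
    arrows G i j ≡ δ (prev j) (forwardCount (G (prev j))) i ℕ.+ δ (next j) (backwardCount (G j)) i
  arrows-column i j with j ≟ next i | i ≟ next j | i ≟ prev j
  ... | yes j≡ | _     | no  i≢ = ⊥-elim (i≢ (trans (sym (prev-next i)) (cong prev (sym j≡))))
  ... | no  j≢ | _     | yes i≡ = ⊥-elim (j≢ (trans (sym (next-prev j)) (cong next (sym i≡))))
  ... | yes _  | yes _ | yes refl = refl
  ... | yes _  | no  _ | yes refl = refl
  ... | no  _  | yes _ | no  _ = refl
  ... | no  _  | no  _ | no  _ = refl

  outdeg≡ : ∀ v → outdeg G v ≡ forwardCount (G v) ℕ.+ backwardCount (G (prev v))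
  outdeg≡ v = begin
    sumℕ (arrows G v)                                    ≡⟨ sumℕ≡sum (arrows G v) ⟩
    ℕΣ.sum (arrows G v)                                  ≡⟨ ℕΣ.sum-cong-≗ (arrows-row v) ⟩
    ℕΣ.sum (λ w → δ (next v) fc w ℕ.+ δ (prev v) bc w)   ≡⟨ ℕΣ.∑-distrib-+ (δ (next v) fc) (δ (prev v) bc) ⟩
    ℕΣ.sum (δ (next v) fc) ℕ.+ ℕΣ.sum (δ (prev v) bc)    ≡⟨ cong₂ ℕ._+_ (sum-δ (next v) fc) (sum-δ (prev v) bc) ⟩
    fc ℕ.+ bc                                            ∎
    where
    open ≡-Reasoning
    fc bc : ℕ
    fc = forwardCount (G v)
    bc = backwardCount (G (prev v))

module _ {k} (G : CycleGraph (suc (suc k))) where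

  arrows-loop : ∀ i → arrows G i i ≡ 0
  arrows-loop i = begin
    arrows G i i                              ≡⟨ arrows-row G i i ⟩
    δ (next i) a i ℕ.+ δ (prev i) b i         ≡⟨ cong₂ ℕ._+_ (δ-other a (next≢ i ∘ sym)) (δ-other b i≢prev) ⟩
    0                                         ∎
    where
    open ≡-Reasoning
    a b : ℕ
    a = forwardCount (G i)
    b = backwardCount (G (prev i))
    i≢prev : i ≢ prev i
    i≢prev i≡ = next≢ i (trans (cong next i≡) (next-prev i))

  laplacian≡ : ∀ i j → laplacian G i j ≡ + δ j (outdeg G j) i - + arrows G i j
  laplacian≡ i j with i ≟ j
  ... | yes refl = sym (trans (cong (λ a → + outdeg G i - + a) (arrows-loop i)) (ℤP.+-identityʳ _))
  ... | no  _    = sym (ℤP.+-identityˡ _)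

  laplacian-column : ∀ (y : ℤVec (suc (suc k))) j →
    sumℤ (λ i → laplacian G i j * y i) ≡
    + outdeg G j * y j - + forwardCount (G (prev j)) * y (prev j) - + backwardCount (G j) * y (next j)
  laplacian-column y j = begin
    sumℤ (λ i → laplacian G i j * y i)       ≡⟨ sumℤ≡sum (λ i → laplacian G i j * y i) ⟩
    sum (λ i → laplacian G i j * y i)        ≡⟨ sum-cong-≗ entry ⟩
    sum (λ i → D i - A i - B i)              ≡⟨ ∑-distrib-- (λ i → D i - A i) B ⟩
    sum (λ i → D i - A i) - sum B            ≡⟨ cong (_- sum B) (∑-distrib-- D A) ⟩
    sum D - sum A - sum B
      ≡⟨ cong₂ _-_ (cong₂ _-_ (sum-δ* j d y) (sum-δ* (prev j) a y)) (sum-δ* (next j) b y) ⟩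
    + d * y j - + a * y (prev j) - + b * y (next j) ∎
    where
    open ≡-Reasoning
    d a b : ℕ
    d = outdeg G j
    a = forwardCount (G (prev j))
    b = backwardCount (G j)
    D A B : ℤVec (suc (suc k))
    D i = + δ j d i * y i
    A i = + δ (prev j) a i * y i
    B i = + δ (next j) b i * y i
    distrib : ∀ d a b y → (d - (a + b)) * y ≡ d * y - a * y - b * y
    distrib = solve-∀
    entry : ∀ i → laplacian G i j * y i ≡ D i - A i - B i
    entry i = begin
      laplacian G i j * y i                                    ≡⟨ cong (_* y i) (laplacian≡ i j) ⟩
      (+ δ j d i - + arrows G i j) * y i                       ≡⟨ cong (λ t → (+ δ j d i - + t) * y i) (arrows-column G i j) ⟩
      (+ δ j d i - + (δ (prev j) a i ℕ.+ δ (next j) b i)) * y i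
        ≡⟨ cong (λ t → (+ δ j d i - t) * y i) (ℤP.pos-+ (δ (prev j) a i) (δ (next j) b i)) ⟩
      (+ δ j d i - (+ δ (prev j) a i + + δ (next j) b i)) * y i
        ≡⟨ distrib (+ δ j d i) (+ δ (prev j) a i) (+ δ (next j) b i) (y i) ⟩
      D i - A i - B i                                          ∎

module _ {k : ℕ} where

  Δ ∂ : ℤVec (suc k) → ℤVec (suc k)
  Δ w j = + 2 * w j - w (prev j) - w (next j)
  ∂ w i = w (next i) - w i

  index : ℤVec (suc k)
  index i = + toℕ i

  moment : ℤVec (suc k) → ℤ
  moment x = sum (λ j → index j * x j)

  Δ-cong : ∀ {v w} → v ≗ w → ∀ j → Δ v j ≡ Δ w j
  Δ-cong v≗w j = cong₂ _-_ (cong₂ (λ a b → + 2 * a - b) (v≗w j) (v≗w (prev j))) (v≗w (next j))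

  Δ≡∂∘prev-∂ : ∀ w j → Δ w j ≡ ∂ w (prev j) - ∂ w j
  Δ≡∂∘prev-∂ w j = begin
    + 2 * w j - w (prev j) - w (next j)          ≡⟨ regroup (w j) (w (prev j)) (w (next j)) ⟩
    (w j - w (prev j)) - (w (next j) - w j)      ≡⟨ cong (λ t → (w t - w (prev j)) - ∂ w j) (next-prev j) ⟨
    ∂ w (prev j) - ∂ w j                         ∎
    where
    open ≡-Reasoning
    regroup : ∀ a b c → + 2 * a - b - c ≡ (a - b) - (c - a)
    regroup = solve-∀

  sum-∂ : ∀ w → sum (∂ w) ≡ + 0
  sum-∂ w = begin
    sum (∂ w)                 ≡⟨ ∑-distrib-- (w ∘ next) w ⟩
    sum (w ∘ next) - sum w    ≡⟨ cong (_- sum w) (sum-∘next w) ⟩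
    sum w - sum w             ≡⟨ ℤP.+-inverseʳ (sum w) ⟩
    + 0                       ∎
    where open ≡-Reasoning

  sum-Δ : ∀ w → sum (Δ w) ≡ + 0
  sum-Δ w = begin
    sum (Δ w)                                 ≡⟨ sum-cong-≗ (Δ≡∂∘prev-∂ w) ⟩
    sum (λ j → ∂ w (prev j) - ∂ w j)          ≡⟨ ∑-distrib-- (∂ w ∘ prev) (∂ w) ⟩
    sum (∂ w ∘ prev) - sum (∂ w)              ≡⟨ cong (_- sum (∂ w)) (sum-∘prev (∂ w)) ⟩
    sum (∂ w) - sum (∂ w)                     ≡⟨ ℤP.+-inverseʳ (sum (∂ w)) ⟩
    + 0                                       ∎
    where open ≡-Reasoning

  summation-by-parts : ∀ (a d : ℤVec (suc k)) → sum (λ j → a j * (d (prev j) - d j)) ≡ sum (λ i → ∂ a i * d i)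
  summation-by-parts a d = begin
    sum (λ j → a j * (d (prev j) - d j))                    ≡⟨ sum-cong-≗ (λ j → distribˡ (a j) (d (prev j)) (d j)) ⟩
    sum (λ j → a j * d (prev j) - a j * d j)                ≡⟨ ∑-distrib-- (λ j → a j * d (prev j)) (λ j → a j * d j) ⟩
    sum (λ j → a j * d (prev j)) - sum (λ j → a j * d j)    ≡⟨ cong (_- sum (λ j → a j * d j)) shift ⟩
    sum (λ i → a (next i) * d i) - sum (λ i → a i * d i)    ≡⟨ ∑-distrib-- (λ i → a (next i) * d i) (λ i → a i * d i) ⟨
    sum (λ i → a (next i) * d i - a i * d i)                ≡⟨ sum-cong-≗ (λ i → distribʳ (a (next i)) (a i) (d i)) ⟨
    sum (λ i → ∂ a i * d i)                                 ∎
    where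
    open ≡-Reasoning
    distribˡ : ∀ x y z → x * (y - z) ≡ x * y - x * z
    distribˡ = solve-∀
    distribʳ : ∀ x y z → (x - y) * z ≡ x * z - y * z
    distribʳ = solve-∀
    shift : sum (λ j → a j * d (prev j)) ≡ sum (λ i → a (next i) * d i)
    shift = trans (sym (sum-∘next (λ j → a j * d (prev j))))
                  (sum-cong-≗ (λ i → cong (λ t → a (next i) * d t) (prev-next i)))

  ∂index-inject₁ : ∀ (i : Fin k) → ∂ index (inject₁ i) ≡ + 1
  ∂index-inject₁ i = begin
    + toℕ (next (inject₁ i)) - + toℕ (inject₁ i)  ≡⟨ cong₂ (λ s t → + toℕ s - + t) (next-inject₁ i) (toℕ-inject₁ i) ⟩
    + suc (toℕ i) - + toℕ i                      ≡⟨ cong (_- + toℕ i) (ℤP.pos-+ 1 (toℕ i)) ⟩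
    + 1 + + toℕ i - + toℕ i                      ≡⟨ cancel (+ 1) (+ toℕ i) ⟩
    + 1                                          ∎
    where
    open ≡-Reasoning
    cancel : ∀ a b → a + b - b ≡ a
    cancel = solve-∀

  ∂index-fromℕ : ∂ index (fromℕ k) ≡ - + k
  ∂index-fromℕ = trans (cong₂ (λ s t → + toℕ s - + t) (next-fromℕ k) (toℕ-fromℕ k)) (ℤP.+-identityˡ (- + k))

  sum-∂index* : ∀ (f : ℤVec (suc k)) → sum (λ i → ∂ index i * f i) ≡ sum f - + suc k * f (fromℕ k)
  sum-∂index* f = begin
    sum (λ i → ∂ index i * f i)                                  ≡⟨ sum-init-last (λ i → ∂ index i * f i) ⟩
    sum (λ i → ∂ index (inject₁ i) * f (inject₁ i)) + ∂ index (fromℕ k) * f (fromℕ k)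
        ≡⟨ cong₂ _+_ (sum-cong-≗ (λ i → trans (cong (_* f (inject₁ i)) (∂index-inject₁ i)) (ℤP.*-identityˡ _)))
                     (cong (_* f (fromℕ k)) ∂index-fromℕ) ⟩
    sum (f ∘ inject₁) + - + k * f (fromℕ k)                      ≡⟨ regroup (sum (f ∘ inject₁)) (+ k) (f (fromℕ k)) ⟩
    (sum (f ∘ inject₁) + f (fromℕ k)) - (+ 1 + + k) * f (fromℕ k)
      ≡⟨ cong₂ (λ s t → s - t * f (fromℕ k)) (sum-init-last f) (ℤP.pos-+ 1 k) ⟨
    sum f - + suc k * f (fromℕ k)                                ∎
    where
    open ≡-Reasoning
    regroup : ∀ s k l → s + - k * l ≡ (s + l) - (+ 1 + k) * l
    regroup = solve-∀

  moment-Δ : ∀ w → moment (Δ w) ≡ (w (fromℕ k) - w zero) * + suc k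
  moment-Δ w = begin
    sum (λ j → index j * Δ w j)                          ≡⟨ sum-cong-≗ (λ j → cong (index j *_) (Δ≡∂∘prev-∂ w j)) ⟩
    sum (λ j → index j * (∂ w (prev j) - ∂ w j))         ≡⟨ summation-by-parts index (∂ w) ⟩
    sum (λ i → ∂ index i * ∂ w i)                        ≡⟨ sum-∂index* (∂ w) ⟩
    sum (∂ w) - + suc k * ∂ w (fromℕ k)
      ≡⟨ cong₂ (λ s t → s - + suc k * (w t - w (fromℕ k))) (sum-∂ w) (next-fromℕ k) ⟩
    + 0 - + suc k * (w zero - w (fromℕ k))               ≡⟨ flip (+ suc k) (w zero) (w (fromℕ k)) ⟩
    (w (fromℕ k) - w zero) * + suc k                     ∎
    where
    open ≡-Reasoning
    flip : ∀ n a b → + 0 - n * (a - b) ≡ (b - a) * n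
    flip = solve-∀

at : ∀ {n} → ℤVec n → ℕ → ℤ
at {zero}  x _       = + 0
at {suc n} x zero    = x zero
at {suc n} x (suc t) = at (x ∘ suc) t

at-toℕ : ∀ {n} (x : ℤVec n) j → at x (toℕ j) ≡ x j
at-toℕ x zero    = refl
at-toℕ x (suc j) = at-toℕ (x ∘ suc) j

psum : (ℕ → ℤ) → ℕ → ℤ
psum h zero    = + 0
psum h (suc t) = psum h t + h t

sum∘toℕ≡psum : ∀ {n} (h : ℕ → ℤ) → sum {n} (h ∘ toℕ) ≡ psum h n
sum∘toℕ≡psum {zero}  h = refl
sum∘toℕ≡psum {suc n} h = begin
  sum {suc n} (h ∘ toℕ)                            ≡⟨ sum-init-last {n} (h ∘ toℕ) ⟩
  sum {n} (h ∘ toℕ ∘ inject₁) + h (toℕ (fromℕ n))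
    ≡⟨ cong₂ _+_ (sum-cong-≗ (cong h ∘ toℕ-inject₁ {n})) (cong h (toℕ-fromℕ n)) ⟩
  sum {n} (h ∘ toℕ) + h n                          ≡⟨ cong (_+ h n) (sum∘toℕ≡psum {n} h) ⟩
  psum h n + h n                                   ∎
  where open ≡-Reasoning

module _ {k} (x : ℤVec (suc k)) (c : ℤ) where

  -- The forward differences of the potential are −c − (x₀ + … + x_t); it returns to 0
  -- after n steps because sum x = 0 and moment x = c·n.
  potential : ℕ → ℤ
  potential zero    = + 0
  potential (suc t) = potential t - c - psum (at x) (suc t)

  potential-closed : ∀ t → potential t ≡ - (+ t * c) - + t * psum (at x) t + psum (λ i → + i * at x i) t
  potential-closed zero    = refl
  potential-closed (suc t) = begin
    potential t - c - psum (at x) (suc t)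
      ≡⟨ cong (λ s → s - c - psum (at x) (suc t)) (potential-closed t) ⟩
    - (+ t * c) - + t * P + Q - c - (P + X)
      ≡⟨ step (+ t) c P X Q ⟩
    - ((+ 1 + + t) * c) - (+ 1 + + t) * (P + X) + (Q + + t * X)
      ≡⟨ cong (λ s → - (s * c) - s * (P + X) + (Q + + t * X)) (ℤP.pos-+ 1 t) ⟨
    - (+ suc t * c) - + suc t * psum (at x) (suc t) + psum (λ i → + i * at x i) (suc t) ∎
    where
    open ≡-Reasoning
    P Q X : ℤ
    P = psum (at x) t
    Q = psum (λ i → + i * at x i) t
    X = at x t
    step : ∀ t c p x q → - (t * c) - t * p + q - c - (p + x) ≡ - ((+ 1 + t) * c) - (+ 1 + t) * (p + x) + (q + t * x)
    step = solve-∀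

  module _ (sum≡0 : sum x ≡ + 0) (moment≡ : moment x ≡ c * + suc k) where

    private
     total : psum (at x) (suc k) ≡ + 0
     total = trans (sym (sum∘toℕ≡psum {suc k} (at x))) (trans (sum-cong-≗ (at-toℕ x)) sum≡0)

     first-moment : psum (λ i → + i * at x i) (suc k) ≡ c * + suc k
     first-moment = trans (sym (sum∘toℕ≡psum {suc k} (λ i → + i * at x i)))
                          (trans (sum-cong-≗ (λ j → cong (index j *_) (at-toℕ x j))) moment≡)

    potential-period : potential (suc k) ≡ + 0
    potential-period = begin
      potential (suc k)                                                  ≡⟨ potential-closed (suc k) ⟩
      - (+ suc k * c) - + suc k * psum (at x) (suc k) + psum (λ i → + i * at x i) (suc k)
        ≡⟨ cong₂ (λ p q → - (+ suc k * c) - + suc k * p + q) total first-moment ⟩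
      - (+ suc k * c) - + suc k * + 0 + c * + suc k                       ≡⟨ cancel (+ suc k) c ⟩
      + 0                                                                ∎
      where
      open ≡-Reasoning
      cancel : ∀ n c → - (n * c) - n * + 0 + c * n ≡ + 0
      cancel = solve-∀

    potential-last : potential k ≡ c
    potential-last = ℤP.i-j≡0⇒i≡j (potential k) c (begin
      potential k - c                   ≡⟨ ℤP.+-identityʳ (potential k - c) ⟨
      potential k - c - + 0             ≡⟨ cong (λ p → potential k - c - p) total ⟨
      potential (suc k)                 ≡⟨ potential-period ⟩
      + 0                               ∎)
      where open ≡-Reasoning

    potential-next : ∀ (j : Fin (suc k)) → potential (toℕ (next j)) ≡ potential (suc (toℕ j))
    potential-next j with view j
    ... | ‵fromℕ = begin
      potential (toℕ (next (fromℕ k)))  ≡⟨ cong (potential ∘ toℕ) (next-fromℕ k) ⟩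
      + 0                               ≡⟨ potential-period ⟨
      potential (suc k)                 ≡⟨ cong (potential ∘ suc) (toℕ-fromℕ k) ⟨
      potential (suc (toℕ (fromℕ k)))   ∎
      where open ≡-Reasoning
    ... | ‵inj₁ {i = i} _ =
      trans (cong (potential ∘ toℕ) (next-inject₁ i)) (cong (potential ∘ suc) (sym (toℕ-inject₁ i)))

    Δ-potential : ∀ j → Δ (potential ∘ toℕ) j ≡ x j
    Δ-potential zero = begin
      + 2 * + 0 - potential (toℕ (fromℕ k)) - potential (toℕ (next {k} zero))
        ≡⟨ cong₂ (λ a b → + 2 * + 0 - a - b) (trans (cong potential (toℕ-fromℕ k)) potential-last) (potential-next zero) ⟩
      + 2 * + 0 - c - (+ 0 - c - (+ 0 + x zero))  ≡⟨ wrap-around c (x zero) ⟩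
      x zero                                      ∎
      where
      open ≡-Reasoning
      wrap-around : ∀ c a → + 2 * + 0 - c - (+ 0 - c - (+ 0 + a)) ≡ a
      wrap-around = solve-∀
    Δ-potential (suc i) = begin
      + 2 * potential (suc t) - potential (toℕ (inject₁ i)) - potential (toℕ (next (suc i)))
        ≡⟨ cong₂ (λ a b → + 2 * potential (suc t) - a - b) (cong potential (toℕ-inject₁ i)) (potential-next (suc i)) ⟩
      + 2 * potential (suc t) - potential t - potential (suc (suc t))
        ≡⟨ second-difference (potential t) c (psum (at x) (suc t)) (at x (suc t)) ⟩
      at x (suc t)                                ≡⟨ at-toℕ x (suc i) ⟩
      x (suc i)                                   ∎
      where
      open ≡-Reasoning
      t : ℕ
      t = toℕ i
      second-difference : ∀ a c p q → + 2 * (a - c - p) - a - ((a - c - p) - c - (p + q)) ≡ q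
      second-difference = solve-∀

Δ-solvable : ∀ {k} (x : ℤVec (suc k)) c → sum x ≡ + 0 → moment x ≡ c * + suc k →
             ∃ λ w → w zero ≡ + 0 × (∀ j → Δ w j ≡ x j)
Δ-solvable x c sum≡0 moment≡ = potential x c ∘ toℕ , refl , Δ-potential x c sum≡0 moment≡

moment-additive : ∀ {k} → Additive (moment {k})
moment-additive x y = trans (sum-cong-≗ (λ j → ℤP.*-distribˡ-+ (index j) (x j) (y j)))
                            (∑-distrib-+ (λ j → index j * x j) (λ j → index j * y j))

sum-scale : ∀ {k} c (x : ℤVec (suc k)) → sum (c ·ᵥ x) ≡ c * sum x
sum-scale c x = sym (*-distribˡ-sum c x)

moment-scale : ∀ {k} c (x : ℤVec (suc k)) → moment (c ·ᵥ x) ≡ c * moment x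
moment-scale c x = trans (sum-cong-≗ (λ j → swap (index j) c (x j))) (sym (*-distribˡ-sum c (λ j → index j * x j)))
  where
  swap : ∀ a b c → a * (b * c) ≡ b * (a * c)
  swap = solve-∀

sum-moment-surjective : ∀ {k} a b → ∃ λ (x : ℤVec (suc (suc k))) → sum x ≡ a × moment x ≡ b
sum-moment-surjective {k} a b = x , sum-x , moment-x
  where
  x : ℤVec (suc (suc k))
  x zero          = a - b
  x (suc zero)    = b
  x (suc (suc _)) = + 0
  sum-x : sum x ≡ a
  sum-x = trans (cong (λ s → (a - b) + (b + s)) (sum-replicate-zero k)) (cancel a b)
    where
    cancel : ∀ a b → (a - b) + (b + + 0) ≡ a
    cancel = solve-∀
  moment-x : moment x ≡ b
  moment-x = trans (cong (λ s → + 0 * (a - b) + (+ 1 * b + s))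
                         (trans (sum-cong-≗ (λ i → ℤP.*-zeroʳ (index {suc k} (suc (suc i))))) (sum-replicate-zero k)))
                   (cancel a b)
    where
    cancel : ∀ a b → + 0 * (a - b) + (+ 1 * b + + 0) ≡ b
    cancel = solve-∀

≡[mod]0⇔ : ∀ a n → a ≡[mod n ] + 0 ⇔ ∃ λ q → a ≡ q * + n
≡[mod]0⇔ a n = mk⇔ quotient-of (λ (q , a≡) → Signed.∣⇒∣ᵤ (Signed.divides q (trans (ℤP.+-identityʳ a) a≡)))
  where
  quotient-of : a ≡[mod n ] + 0 → ∃ λ q → a ≡ q * + n
  quotient-of n∣a with Signed.∣ᵤ⇒∣ {+ n} {a - + 0} n∣a
  ... | Signed.divides q a≡ = q , trans (sym (ℤP.+-identityʳ a)) a≡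

≡⇒≡[mod] : ∀ {a b} n → a ≡ b → a ≡[mod n ] b
≡⇒≡[mod] {a} n refl = Signed.∣⇒∣ᵤ {+ n} (Signed.divides (+ 0) (ℤP.+-inverseʳ a))

nonRoot : ∀ {k} → Fin (suc k) → ℕ
nonRoot zero    = 0
nonRoot (suc _) = 1

arrow-counts-from-outdeg : ∀ {k} (i : Fin (suc k)) a b →
  forwardCount a ℕ.+ backwardCount b ≡ nonRoot i ℕ.+ nonRoot i →
  forwardCount a ≡ nonRoot i × backwardCount b ≡ nonRoot i
arrow-counts-from-outdeg zero    bwd  fwd  _  = refl , refl
arrow-counts-from-outdeg zero    fwd  _    ()
arrow-counts-from-outdeg zero    both _    ()
arrow-counts-from-outdeg zero    bwd  bwd  ()
arrow-counts-from-outdeg zero    bwd  both ()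
arrow-counts-from-outdeg (suc _) fwd  bwd  _  = refl , refl
arrow-counts-from-outdeg (suc _) fwd  both _  = refl , refl
arrow-counts-from-outdeg (suc _) both bwd  _  = refl , refl
arrow-counts-from-outdeg (suc _) both both _  = refl , refl
arrow-counts-from-outdeg (suc _) fwd  fwd  ()
arrow-counts-from-outdeg (suc _) both fwd  ()
arrow-counts-from-outdeg (suc _) bwd  fwd  ()
arrow-counts-from-outdeg (suc _) bwd  bwd  ()
arrow-counts-from-outdeg (suc _) bwd  both ()

module SinkCycle {k} (G : CycleGraph (suc (suc k))) (sink : outdeg G zero ≡ 0)
                 (twoOut : ∀ (i : Fin (suc (suc k))) → i ≢ zero → outdeg G i ≡ 2) where

  n : ℕ
  n = suc (suc k)

  outdeg≡nonRoot : ∀ i → outdeg G i ≡ nonRoot i ℕ.+ nonRoot i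
  outdeg≡nonRoot zero    = sink
  outdeg≡nonRoot (suc i) = twoOut (suc i) λ ()

  arrow-counts : ∀ i → forwardCount (G i) ≡ nonRoot i × backwardCount (G (prev i)) ≡ nonRoot i
  arrow-counts i = arrow-counts-from-outdeg i (G i) (G (prev i)) (trans (sym (outdeg≡ G i)) (outdeg≡nonRoot i))

  column : ∀ y j → sumℤ (λ i → laplacian G i j * y i) ≡ Δ (λ i → + nonRoot i * y i) j
  column y j = begin
    sumℤ (λ i → laplacian G i j * y i)
      ≡⟨ laplacian-column G y j ⟩
    + outdeg G j * y j - + forwardCount (G (prev j)) * y (prev j) - + backwardCount (G j) * y (next j)
      ≡⟨ cong₂ _-_ (cong₂ _-_ diagonal (cong (λ t → + t * y (prev j)) (proj₁ (arrow-counts (prev j)))))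
                   (cong (λ t → + t * y (next j)) backward) ⟩
    Δ (λ i → + nonRoot i * y i) j  ∎
    where
    open ≡-Reasoning
    double : ∀ a y → (a + a) * y ≡ + 2 * (a * y)
    double = solve-∀
    diagonal : + outdeg G j * y j ≡ + 2 * (+ nonRoot j * y j)
    diagonal = trans (cong (λ t → + t * y j) (outdeg≡nonRoot j))
                     (trans (cong (_* y j) (ℤP.pos-+ (nonRoot j) (nonRoot j))) (double (+ nonRoot j) (y j)))
    backward : backwardCount (G j) ≡ nonRoot (next j)
    backward = trans (cong (backwardCount ∘ G) (sym (prev-next j))) (proj₂ (arrow-counts (next j)))

  image⇔ : ∀ x → InImLT G x ⇔ (sum x ≡ + 0 × moment x ≡[mod n ] + 0)
  image⇔ x = mk⇔ to from
    where
    to : InImLT G x → sum x ≡ + 0 × moment x ≡[mod n ] + 0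
    to (y , x≡) = trans (sum-cong-≗ x≗Δz) (sum-Δ z)
                , Equivalence.from (≡[mod]0⇔ (moment x) n)
                    (z (fromℕ (suc k)) - z zero , trans (sum-cong-≗ (λ j → cong (index j *_) (x≗Δz j))) (moment-Δ z))
      where
      z : ℤVec n
      z i = + nonRoot i * y i
      x≗Δz : x ≗ Δ z
      x≗Δz j = trans (x≡ j) (column y j)
    from : sum x ≡ + 0 × moment x ≡[mod n ] + 0 → InImLT G x
    from (sum≡0 , n∣moment) with Equivalence.to (≡[mod]0⇔ (moment x) n) n∣moment
    ... | q , moment≡ with Δ-solvable x q sum≡0 moment≡
    ... | w , w0≡0 , Δw≗x = w , λ j → sym (trans (column w j) (trans (Δ-cong dropRoot j) (Δw≗x j)))
      where
      dropRoot : (λ i → + nonRoot i * w i) ≗ w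
      dropRoot zero    = sym w0≡0
      dropRoot (suc i) = ℤP.*-identityˡ (w (suc i))

  sum≡0⇒torsion : ∀ x → sum x ≡ + 0 → IsTorsionInPic G x
  sum≡0⇒torsion x sum≡0 = suc k , Equivalence.from (image⇔ ((+ n) ·ᵥ x))
    ( trans (sum-scale (+ n) x) (trans (cong (_*_ (+ n)) sum≡0) (ℤP.*-zeroʳ (+ n)))
    , Equivalence.from (≡[mod]0⇔ _ n) (moment x , trans (moment-scale (+ n) x) (ℤP.*-comm (+ n) (moment x))))

  torsion⇒sum≡0 : ∀ x → IsTorsionInPic G x → sum x ≡ + 0
  torsion⇒sum≡0 x (m , im) = ℤP.*-cancelˡ-≡ (+ suc m) (sum x) (+ 0)
    (trans (sym (sum-scale (+ suc m) x)) (trans (proj₁ (Equivalence.to (image⇔ _) im)) (sym (ℤP.*-zeroʳ (+ suc m)))))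

  picIso : PicIsoℤ×ℤ/ G n
  picIso = sum , moment , ∑-distrib-+ , moment-additive
         , (λ a b → let x , sum≡a , moment≡b = sum-moment-surjective a b in x , sum≡a , ≡⇒≡[mod] n moment≡b)
         , image⇔

  jacIso : JacIsoℤ/ G n
  jacIso = moment , moment-additive
         , (λ b → let x , sum≡0 , moment≡b = sum-moment-surjective (+ 0) b
                  in x , sum≡0⇒torsion x sum≡0 , ≡⇒≡[mod] n moment≡b)
         , (λ x torsion → mk⇔ (proj₂ ∘ Equivalence.to (image⇔ x))
                              (λ n∣moment → Equivalence.from (image⇔ x) (torsion⇒sum≡0 x torsion , n∣moment)))

lemma4p16 : (m : ℕ) → (G : CycleGraph (suc (suc (suc m))))
    → outdeg G zero ≡ 0
    → (∀ (i : Fin (suc (suc (suc m)))) → i ≢ zero → outdeg G i ≡ 2)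
    → PicIsoℤ×ℤ/ G (suc (suc (suc m))) × JacIsoℤ/ G (suc (suc (suc m)))
lemma4p16 m G sink twoOut = picIso , jacIso
  where open SinkCycle G sink twoOut
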